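{- If $n$ is even but not a power of $2$, then there is a transitive permutation group $G$ of degree $n$ such that $\Gamma_G$ is a complete multipartite graph with $n/2$ parts.
   Context: For a permutation group $K$ on a finite set, an element is a derangement if it fixes no point. The derangement graph $\Gamma_K$ is the graph with vertex set $K$ in which distinct $g,h$ are adjacent iff $gh^{ -1}$ is a derangement. -}

module Defs where

open import Level using (0ℓ)
open import Data.Nat using (ℕ; _^_)
open import Data.Fin using (Fin)
open import Data.Fin.Permutation using (Permutation′; _⟨$⟩ʳ_; _≈_; id; flip; _∘ₚ_)
open import Data.Product using (Σ; ∃; _×_; _,_; proj₁)
open import Function using (Surjective)
open import Function.Bundles using (_⇔_)
open import Relation.Binary.PropositionalEquality using (_≡_; _≢_)
open import Relation.Nullary using (¬_)
open import Relation.Unary using (Pred; _∈_)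

IsPowerOf2 : ℕ → Set
IsPowerOf2 n = ∃ λ k → n ≡ 2 ^ k

record IsPermGroup (n : ℕ) (G : Pred (Permutation′ n) 0ℓ) : Set where
  field
    resp  : ∀ {π σ} → π ≈ σ → π ∈ G → σ ∈ G
    id∈   : id ∈ G
    ∘∈    : ∀ {π σ} → π ∈ G → σ ∈ G → (π ∘ₚ σ) ∈ G
    inv∈  : ∀ {π} → π ∈ G → flip π ∈ G

IsTransitive : (n : ℕ) → Pred (Permutation′ n) 0ℓ → Set
IsTransitive n G = ∀ (i j : Fin n) → ∃ λ π → π ∈ G × π ⟨$⟩ʳ i ≡ j

IsDerangement : {n : ℕ} → Permutation′ n → Set
IsDerangement π = ∀ i → π ⟨$⟩ʳ i ≢ i

-- g h⁻¹ as a map: x ↦ g (h⁻¹ x)   (∘ₚ is diagrammatic: apply left first)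
_·_⁻¹ : {n : ℕ} → Permutation′ n → Permutation′ n → Permutation′ n
g · h ⁻¹ = flip h ∘ₚ g

Elt : {n : ℕ} → Pred (Permutation′ n) 0ℓ → Set
Elt {n} G = Σ (Permutation′ n) (λ π → π ∈ G)

Adj : {n : ℕ} (G : Pred (Permutation′ n) 0ℓ) → Elt G → Elt G → Set
Adj G (g , _) (h , _) = ¬ (g ≈ h) × IsDerangement (g · h ⁻¹)

-- Γ_G is complete multipartite with k parts: the vertex set is partitioned
-- into k nonempty parts (a surjective, well-defined part map) such that two
-- vertices are adjacent iff they lie in different parts.
DerangementGraphCompleteMultipartite : {n : ℕ} (G : Pred (Permutation′ n) 0ℓ) (k : ℕ) → Set
DerangementGraphCompleteMultipartite G k =
  Σ (Elt G → Fin k) λ part →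
    Surjective _≡_ _≡_ part
    × (∀ x y → proj₁ x ≈ proj₁ y → part x ≡ part y)
    × (∀ x y → ¬ (proj₁ x ≈ proj₁ y) → (Adj G x y ⇔ part x ≢ part y))

module Submission where

-- Write m = 2^k q with q odd and q ≥ 3, and let G act on Bool × ℤ/m by the maps
-- (b , x) ↦ (b xor w x , x + c) where w x = v x xor v (x + 1) for a q-periodic v : ℤ → Bool
-- (well defined on ℤ/m as q ∣ m). If c ≢ 0 the map moves every point. If c ≡ 0, v is a
-- 2-colouring of the odd cycle ℤ/q, so it has a monochromatic edge, i.e. a zero of w, and the map
-- fixes a point. Hence the derangements are exactly the elements with c ≢ 0, and Γ_G is complete
-- multipartite, its m parts being the fibres of g ↦ c mod m.

open import Defs
open import Level using (0ℓ)
open import Algebra.Bundles using (CommutativeRing)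
import Algebra.Properties.CommutativeSemigroup as CommutativeSemigroupProperties
open import Data.Bool using (Bool; false; not; _xor_; _∧_; _≟_)
open import Data.Bool.Properties
  using (xor-assoc; xor-same; xor-identityʳ; xor-∧-commutativeRing; ∧-zeroʳ; ∧-identityʳ;
         ¬-not; not-involutive)
open import Data.Fin using (Fin; toℕ; fromℕ<)
open import Data.Fin.Properties using (toℕ-injective; toℕ<n; toℕ-fromℕ<; 2↔Bool; *↔×)
open import Data.Fin.Permutation
  using (Permutation′; _⟨$⟩ʳ_; _⟨$⟩ˡ_; _≈_; id; flip; _∘ₚ_; inverseˡ; inverseʳ)
open import Data.Nat using (ℕ; zero; suc; _+_; _*_; _^_; _<_; pred; NonZero; >-nonZero⁻¹; s≤s; z≤n)
import Data.Nat.Properties as ℕ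
open import Data.Nat.Properties
  using (+-identityʳ; +-assoc; +-comm; *-assoc; *-identityʳ; *-suc; suc-pred; <-≤-trans)
  renaming (_≟_ to _≟ₙ_)
open import Data.Nat.DivMod
  using (_%_; _mod_; %-distribˡ-+; m%n%n≡m%n; m%n<n; m<n⇒m%n≡m; n%n≡0; %-remove-+ˡ; %-remove-+ʳ;
         m∣n⇒o%n%m≡o%m)
open import Data.Nat.Divisibility using (_∣_; divides; m∣m*n; n∣m⇒m%n≡0; ∣⇒≤)
open import Data.Nat.Induction using (<-rec)
open import Data.Product using (Σ; ∃; ∃₂; _×_; _,_; proj₁; proj₂; uncurry)
open import Data.Product.Function.NonDependent.Propositional using (_×-↔_)
open import Data.Sum using (_⊎_; inj₁; inj₂)
open import Function using (_∘_; Inverse; Equivalence; _↔_; _⇔_; mk⇔; mk↔ₛ′; StrictlySurjective)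
open import Function.Consequences.Propositional using (strictlySurjective⇒surjective)
open import Function.Construct.Composition using (_↔-∘_)
open import Function.Construct.Identity using (↔-id)
open import Function.Construct.Symmetry using (↔-sym)
open import Function.Properties.Equivalence using () renaming (trans to ⇔-trans)
open import Relation.Binary.PropositionalEquality
open import Relation.Nullary using (¬_; does; yes; no; contradiction)
open import Relation.Nullary.Decidable using (dec-true; dec-false)
open import Relation.Unary using (Pred; _∈_)

open CommutativeSemigroupProperties ℕ.+-commutativeSemigroup using (x∙yz≈yx∙z)
open CommutativeSemigroupProperties (CommutativeRing.+-commutativeSemigroup xor-∧-commutativeRing)
  using () renaming (interchange to xor-interchange)

parity : ∀ n → ∃ λ h → n ≡ 2 * h ⊎ suc n ≡ 2 * suc h
parity zero = 0 , inj₁ refl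
parity (suc n) with parity n
... | h , inj₁ n≡2h = h , inj₂ (trans (cong (suc ∘ suc) n≡2h) (sym (*-suc 2 h)))
... | h , inj₂ 1+n≡2+2h = suc h , inj₁ 1+n≡2+2h

odd-part : ∀ n → ∃₂ λ k r → suc n ≡ 2 ^ k * suc (2 * r)
odd-part = <-rec _ step
  where
  step : ∀ n → (∀ {h} → h < n → ∃₂ λ k r → suc h ≡ 2 ^ k * suc (2 * r)) →
         ∃₂ λ k r → suc n ≡ 2 ^ k * suc (2 * r)
  step n rec with parity n
  ... | h , inj₁ n≡2h = 0 , h , trans (cong suc n≡2h) (sym (+-identityʳ _))
  ... | h , inj₂ 1+n≡2+2h =
    let k , r , 1+h≡ = rec (subst (h <_) (sym (ℕ.suc-injective 1+n≡2+2h)) (ℕ.m<m+n h (s≤s z≤n)))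
    in suc k , r , trans 1+n≡2+2h (trans (cong (2 *_) 1+h≡) (sym (*-assoc 2 (2 ^ k) _)))

[m%o+n]%o≡[m+n]%o : ∀ m n o .{{_ : NonZero o}} → (m % o + n) % o ≡ (m + n) % o
[m%o+n]%o≡[m+n]%o m n o = begin
  (m % o + n) % o            ≡⟨ %-distribˡ-+ (m % o) n o ⟩
  (m % o % o + n % o) % o    ≡⟨ cong (λ x → (x + n % o) % o) (m%n%n≡m%n m o) ⟩
  (m % o + n % o) % o        ≡⟨ %-distribˡ-+ m n o ⟨
  (m + n) % o                ∎
  where open ≡-Reasoning

[m+n%o]%o≡[m+n]%o : ∀ m n o .{{_ : NonZero o}} → (m + n % o) % o ≡ (m + n) % o
[m+n%o]%o≡[m+n]%o m n o = begin
  (m + n % o) % o   ≡⟨ cong (_% o) (+-comm m (n % o)) ⟩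
  (n % o + m) % o   ≡⟨ [m%o+n]%o≡[m+n]%o n m o ⟩
  (n + m) % o       ≡⟨ cong (_% o) (+-comm n m) ⟩
  (m + n) % o       ∎
  where open ≡-Reasoning

m+pred[o]*m≡o*m : ∀ m o .{{_ : NonZero o}} → m + pred o * m ≡ o * m
m+pred[o]*m≡o*m m o = cong (_* m) (suc-pred o)

[m+n]%o≡m%o⇒n%o≡0 : ∀ m n o .{{_ : NonZero o}} → (m + n) % o ≡ m % o → n % o ≡ 0
[m+n]%o≡m%o⇒n%o≡0 m n o eq = begin
  n % o                              ≡⟨ %-remove-+ʳ n (m∣m*n m) ⟨
  (n + o * m) % o                    ≡⟨ cong (λ x → (n + x) % o) (m+pred[o]*m≡o*m m o) ⟨
  (n + (m + pred o * m)) % o         ≡⟨ cong (_% o) (x∙yz≈yx∙z n m (pred o * m)) ⟩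
  ((m + n) + pred o * m) % o         ≡⟨ [m%o+n]%o≡[m+n]%o (m + n) (pred o * m) o ⟨
  ((m + n) % o + pred o * m) % o     ≡⟨ cong (λ x → (x + pred o * m) % o) eq ⟩
  (m % o + pred o * m) % o           ≡⟨ [m%o+n]%o≡[m+n]%o m (pred o * m) o ⟩
  (m + pred o * m) % o               ≡⟨ cong (_% o) (m+pred[o]*m≡o*m m o) ⟩
  (o * m) % o                        ≡⟨ n∣m⇒m%n≡0 (o * m) o (m∣m*n m) ⟩
  0                                  ∎
  where open ≡-Reasoning

odd-cycle-monochromatic : ∀ r (v : ℕ → Bool) → v (suc (2 * r)) ≡ v 0 →
                          ∃ λ z → z < suc (2 * r) × v z ≡ v (suc z)
odd-cycle-monochromatic zero v v1≡v0 = 0 , s≤s z≤n , sym v1≡v0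
odd-cycle-monochromatic (suc r) v v[2r+3]≡v0 with v 0 ≟ v 1 | v 1 ≟ v 2
... | yes v0≡v1 | _         = 0 , s≤s z≤n , v0≡v1
... | no _      | yes v1≡v2 = 1 , s≤s (s≤s z≤n) , v1≡v2
... | no v0≢v1  | no v1≢v2  =
  let z , z<2r+1 , vz≡ = odd-cycle-monochromatic r (v ∘ (2 +_))
                           (trans (cong (v ∘ suc) 2+2r≡) (trans v[2r+3]≡v0 (sym v2≡v0)))
  in 2 + z , subst (2 + z <_) (cong suc 2+2r≡) (s≤s (s≤s z<2r+1)) , vz≡
  where
  2+2r≡ : 2 + 2 * r ≡ 2 * suc r
  2+2r≡ = sym (*-suc 2 r)
  v2≡v0 : v 2 ≡ v 0
  v2≡v0 = trans (¬-not (v1≢v2 ∘ sym)) (trans (cong not (¬-not (v0≢v1 ∘ sym))) (not-involutive (v 0)))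

Periodic : (p : ℕ) .{{_ : NonZero p}} → (ℕ → Bool) → Set
Periodic p v = ∀ {a b} → a % p ≡ b % p → v a ≡ v b

periodic-∣ : ∀ {p q v} .{{_ : NonZero p}} .{{_ : NonZero q}} → q ∣ p → Periodic q v → Periodic p v
periodic-∣ {p} {q} q∣p periodic {a} {b} a≡b = periodic (begin
  a % q       ≡⟨ m∣n⇒o%n%m≡o%m q p a q∣p ⟨
  a % p % q   ≡⟨ cong (_% q) a≡b ⟩
  b % p % q   ≡⟨ m∣n⇒o%n%m≡o%m q p b q∣p ⟩
  b % q       ∎)
  where open ≡-Reasoning

periodic-shift : ∀ {p v} .{{_ : NonZero p}} c → Periodic p v → Periodic p (λ a → v (a + c))
periodic-shift {p} c periodic {a} {b} a≡b = periodic (begin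
  (a + c) % p       ≡⟨ [m%o+n]%o≡[m+n]%o a c p ⟨
  (a % p + c) % p   ≡⟨ cong (λ x → (x + c) % p) a≡b ⟩
  (b % p + c) % p   ≡⟨ [m%o+n]%o≡[m+n]%o b c p ⟩
  (b + c) % p       ∎)
  where open ≡-Reasoning

δ : (ℕ → Bool) → ℕ → Bool
δ v a = v a xor v (suc a)

IsPeriodicCoboundary : (p : ℕ) .{{_ : NonZero p}} → (ℕ → Bool) → Set
IsPeriodicCoboundary p w = ∃ λ v → Periodic p v × (∀ a → w a ≡ δ v a)

module _ {p : ℕ} .{{_ : NonZero p}} where

  coboundary-false : IsPeriodicCoboundary p (λ _ → false)
  coboundary-false = (λ _ → false) , (λ _ → refl) , (λ _ → refl)

  coboundary-xor : ∀ {w w′} → IsPeriodicCoboundary p w → IsPeriodicCoboundary p w′ →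
                   IsPeriodicCoboundary p (λ a → w a xor w′ a)
  coboundary-xor (v , periodic , w≡δv) (v′ , periodic′ , w′≡δv′) =
    (λ a → v a xor v′ a) ,
    (λ a≡b → cong₂ _xor_ (periodic a≡b) (periodic′ a≡b)) ,
    λ a → trans (cong₂ _xor_ (w≡δv a) (w′≡δv′ a))
                (xor-interchange (v a) (v (suc a)) (v′ a) (v′ (suc a)))

  coboundary-shift : ∀ {m w} .{{_ : NonZero m}} → p ∣ m → IsPeriodicCoboundary p w →
                     ∀ c → IsPeriodicCoboundary p (λ a → w ((a + c) % m))
  coboundary-shift {m} {w} p∣m (v , periodic , w≡δv) c =
    (λ a → v (a + c)) , periodic-shift c periodic , shifted
    where
    shifted : ∀ a → w ((a + c) % m) ≡ δ (λ a → v (a + c)) a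
    shifted a = trans (w≡δv ((a + c) % m)) (cong₂ _xor_
      (periodic-∣ p∣m periodic (m%n%n≡m%n (a + c) m))
      (periodic-∣ p∣m periodic ([m+n%o]%o≡[m+n]%o 1 (a + c) m)))

coboundary-vanishes : ∀ r {w} → IsPeriodicCoboundary (suc (2 * r)) w →
                      ∃ λ z → z < suc (2 * r) × w z ≡ false
coboundary-vanishes r {w} (v , periodic , w≡δv) =
  let z , z<q , vz≡vsz = odd-cycle-monochromatic r v (periodic (n%n≡0 (suc (2 * r))))
  in z , z<q , trans (w≡δv z) (trans (cong (v z xor_) (sym vz≡vsz)) (xor-same (v z)))

coboundary-with-value : ∀ p .{{_ : NonZero p}} → 1 < p → ∀ x β →
                   ∃ λ w → IsPeriodicCoboundary p w × w x ≡ β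
coboundary-with-value p 1<p x β = δ v , (v , periodic , λ _ → refl) , δv[x]≡β
  where
  v : ℕ → Bool
  v a = β ∧ does (a % p ≟ₙ suc x % p)
  periodic : Periodic p v
  periodic a≡b = cong (λ r → β ∧ does (r ≟ₙ suc x % p)) a≡b
  x≢1+x : x % p ≢ suc x % p
  x≢1+x x≡1+x = contradiction
    (trans (sym (m<n⇒m%n≡m 1<p))
           ([m+n]%o≡m%o⇒n%o≡0 x 1 p (trans (cong (_% p) (+-comm x 1)) (sym x≡1+x))))
    λ ()
  δv[x]≡β : δ v x ≡ β
  δv[x]≡β = cong₂ _xor_
    (trans (cong (β ∧_) (dec-false (x % p ≟ₙ suc x % p) x≢1+x)) (∧-zeroʳ β))
    (trans (cong (β ∧_) (dec-true (suc x % p ≟ₙ suc x % p) refl)) (∧-identityʳ β))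

module _ {n : ℕ} where

  ∘ₚ-cong : ∀ {π π′ σ σ′ : Permutation′ n} → π ≈ π′ → σ ≈ σ′ → π ∘ₚ σ ≈ π′ ∘ₚ σ′
  ∘ₚ-cong {σ = σ} π≈π′ σ≈σ′ i = trans (cong (σ ⟨$⟩ʳ_) (π≈π′ i)) (σ≈σ′ _)

  flip-cong : ∀ {π σ : Permutation′ n} → π ≈ σ → flip π ≈ flip σ
  flip-cong {π} {σ} π≈σ i = begin
    π ⟨$⟩ˡ i                      ≡⟨ cong (π ⟨$⟩ˡ_) (inverseʳ σ) ⟨
    π ⟨$⟩ˡ (σ ⟨$⟩ʳ (σ ⟨$⟩ˡ i))    ≡⟨ cong (π ⟨$⟩ˡ_) (π≈σ _) ⟨
    π ⟨$⟩ˡ (π ⟨$⟩ʳ (σ ⟨$⟩ˡ i))    ≡⟨ inverseˡ π ⟩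
    σ ⟨$⟩ˡ i                      ∎
    where open ≡-Reasoning

  derangement-resp-≈ : ∀ {π σ : Permutation′ n} → π ≈ σ → IsDerangement π → IsDerangement σ
  derangement-resp-≈ π≈σ π-der i σi≡i = π-der i (trans (π≈σ i) σi≡i)

module Conjugation {n : ℕ} {A : Set} (e : Fin n ↔ A) where
  open Inverse

  conjugate : A ↔ A → Permutation′ n
  conjugate f = ↔-sym e ↔-∘ (f ↔-∘ e)

  conjugate-cong : ∀ f g → (∀ a → to f a ≡ to g a) → conjugate f ≈ conjugate g
  conjugate-cong f g f≗g i = cong (from e) (f≗g (to e i))

  conjugate-id : ∀ f → (∀ a → to f a ≡ a) → conjugate f ≈ id
  conjugate-id f f≗id i = trans (cong (from e) (f≗id (to e i))) (strictlyInverseʳ e i)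

  conjugate-∘ : ∀ f g → conjugate f ∘ₚ conjugate g ≈ conjugate (g ↔-∘ f)
  conjugate-∘ f g i = cong (from e ∘ to g) (strictlyInverseˡ e _)

  flip-conjugate : ∀ f → flip (conjugate f) ≈ conjugate (↔-sym f)
  flip-conjugate f i = refl

  conjugate-derangement : ∀ f → IsDerangement (conjugate f) ⇔ (∀ a → to f a ≢ a)
  conjugate-derangement f = mk⇔
    (λ der a fa≡a →
       der (from e a) (trans (cong (from e ∘ to f) (strictlyInverseˡ e a)) (cong (from e) fa≡a)))
    (λ no-fixed i fi≡i →
       no-fixed (to e i) (trans (sym (strictlyInverseˡ e _)) (cong (to e) fi≡i)))

  module _ {C : Set} (Admissible : C → Set) (T : C → A ↔ A) where

    Image : Pred (Permutation′ n) 0ℓ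
    Image π = ∃ λ c → Admissible c × π ≈ conjugate (T c)

    image-isPermGroup :
      (∃ λ c → Admissible c × ∀ a → to (T c) a ≡ a) →
      (∀ {c d} → Admissible c → Admissible d →
         ∃ λ c′ → Admissible c′ × ∀ a → to (T c′) a ≡ to (T d) (to (T c) a)) →
      (∀ {c} → Admissible c → ∃ λ c′ → Admissible c′ × ∀ a → to (T c′) a ≡ from (T c) a) →
      IsPermGroup n Image
    image-isPermGroup (c₀ , adm-c₀ , T₀≗id) compose invert = record
      { resp = λ π≈σ (c , adm-c , π≈) → c , adm-c , λ i → trans (sym (π≈σ i)) (π≈ i)
      ; id∈  = c₀ , adm-c₀ , λ i → sym (conjugate-id (T c₀) T₀≗id i)
      ; ∘∈   = λ {π} {σ} → ∘-closed {π} {σ}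
      ; inv∈ = λ {π} → inv-closed {π}
      }
      where
      open ≡-Reasoning

      ∘-closed : ∀ {π σ} → π ∈ Image → σ ∈ Image → (π ∘ₚ σ) ∈ Image
      ∘-closed {π} {σ} (c , adm-c , π≈) (d , adm-d , σ≈) =
        let c′ , adm-c′ , T≗ = compose adm-c adm-d
        in c′ , adm-c′ , λ i → begin
          (π ∘ₚ σ) ⟨$⟩ʳ i
            ≡⟨ ∘ₚ-cong {π = π} {conjugate (T c)} {σ} {conjugate (T d)} π≈ σ≈ i ⟩
          (conjugate (T c) ∘ₚ conjugate (T d)) ⟨$⟩ʳ i
            ≡⟨ conjugate-∘ (T c) (T d) i ⟩
          conjugate (T d ↔-∘ T c) ⟨$⟩ʳ i
            ≡⟨ conjugate-cong (T c′) (T d ↔-∘ T c) T≗ i ⟨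
          conjugate (T c′) ⟨$⟩ʳ i
            ∎

      inv-closed : ∀ {π} → π ∈ Image → flip π ∈ Image
      inv-closed {π} (c , adm-c , π≈) =
        let c′ , adm-c′ , T≗ = invert adm-c
        in c′ , adm-c′ , λ i → begin
          flip π ⟨$⟩ʳ i                   ≡⟨ flip-cong {π = π} {conjugate (T c)} π≈ i ⟩
          flip (conjugate (T c)) ⟨$⟩ʳ i   ≡⟨ flip-conjugate (T c) i ⟩
          conjugate (↔-sym (T c)) ⟨$⟩ʳ i  ≡⟨ conjugate-cong (T c′) (↔-sym (T c)) T≗ i ⟨
          conjugate (T c′) ⟨$⟩ʳ i         ∎

    image-transitive : (∀ a b → ∃ λ c → Admissible c × to (T c) a ≡ b) → IsTransitive n Image
    image-transitive reach i j =
      let c , admissible , Tc[i]≡j = reach (to e i) (to e j)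
      in conjugate (T c) , (c , admissible , λ _ → refl) ,
         trans (cong (from e) Tc[i]≡j) (strictlyInverseʳ e j)

complete-multipartite-by-blocks :
  ∀ {n k} {G : Pred (Permutation′ n) 0ℓ} → IsPermGroup n G → IsTransitive n G →
  (block : Fin n → Fin k) → StrictlySurjective _≡_ block → Fin n →
  (∀ {σ} → σ ∈ G → ∀ p → IsDerangement σ ⇔ block (σ ⟨$⟩ʳ p) ≢ block p) →
  DerangementGraphCompleteMultipartite G k
complete-multipartite-by-blocks {n} {k} {G} isGroup transitive block block-surjective p₀ derangement⇔ =
  part , strictlySurjective⇒surjective part-surjective , part-cong , adjacent⇔
  where
  open IsPermGroup isGroup

  part : Elt G → Fin k
  part (π , _) = block (π ⟨$⟩ʳ p₀)

  part-surjective : StrictlySurjective _≡_ part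
  part-surjective j =
    let p , block[p]≡j = block-surjective j
        π , π∈G , πp₀≡p = transitive p₀ p
    in (π , π∈G) , trans (cong block πp₀≡p) block[p]≡j

  part-cong : ∀ x y → proj₁ x ≈ proj₁ y → part x ≡ part y
  part-cong _ _ x≈y = cong block (x≈y p₀)

  adjacent⇔ : ∀ x y → ¬ (proj₁ x ≈ proj₁ y) → Adj G x y ⇔ part x ≢ part y
  adjacent⇔ (g , g∈G) (h , h∈G) g≉h = mk⇔ (to ∘ proj₂) (λ parts≢ → g≉h , from parts≢)
    where
    -- g h⁻¹ sends h p₀ to g p₀
    open Equivalence (subst (λ r → IsDerangement (g · h ⁻¹) ⇔ block r ≢ block (h ⟨$⟩ʳ p₀))
                                     (cong (g ⟨$⟩ʳ_) (inverseˡ h))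
                                     (derangement⇔ (∘∈ (inv∈ h∈G) g∈G) (h ⟨$⟩ʳ p₀)))

module TwistedTranslation (m : ℕ) .{{_ : NonZero m}} where

  infixl 6 _+ₘ_
  _+ₘ_ : Fin m → ℕ → Fin m
  x +ₘ c = (toℕ x + c) mod m

  toℕ-+ₘ : ∀ x c → toℕ (x +ₘ c) ≡ (toℕ x + c) % m
  toℕ-+ₘ x c = toℕ-fromℕ< (m%n<n (toℕ x + c) m)

  +ₘ-assoc : ∀ x c d → x +ₘ c +ₘ d ≡ x +ₘ (c + d)
  +ₘ-assoc x c d = toℕ-injective (begin
    toℕ (x +ₘ c +ₘ d)            ≡⟨ toℕ-+ₘ (x +ₘ c) d ⟩
    (toℕ (x +ₘ c) + d) % m       ≡⟨ cong (λ y → (y + d) % m) (toℕ-+ₘ x c) ⟩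
    ((toℕ x + c) % m + d) % m    ≡⟨ [m%o+n]%o≡[m+n]%o (toℕ x + c) d m ⟩
    (toℕ x + c + d) % m          ≡⟨ cong (_% m) (+-assoc (toℕ x) c d) ⟩
    (toℕ x + (c + d)) % m        ≡⟨ toℕ-+ₘ x (c + d) ⟨
    toℕ (x +ₘ (c + d))           ∎)
    where open ≡-Reasoning

  toℕ%m≡toℕ : ∀ (x : Fin m) → toℕ x % m ≡ toℕ x
  toℕ%m≡toℕ x = m<n⇒m%n≡m (toℕ<n x)

  +ₘ-identity : ∀ x {c} → c % m ≡ 0 → x +ₘ c ≡ x
  +ₘ-identity x {c} c≡0 = toℕ-injective (begin
    toℕ (x +ₘ c)             ≡⟨ toℕ-+ₘ x c ⟩
    (toℕ x + c) % m          ≡⟨ [m+n%o]%o≡[m+n]%o (toℕ x) c m ⟨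
    (toℕ x + c % m) % m      ≡⟨ cong (λ r → (toℕ x + r) % m) c≡0 ⟩
    (toℕ x + 0) % m          ≡⟨ cong (_% m) (+-identityʳ (toℕ x)) ⟩
    toℕ x % m                ≡⟨ toℕ%m≡toℕ x ⟩
    toℕ x                    ∎)
    where open ≡-Reasoning

  +ₘ-fixed⇒%m≡0 : ∀ x c → x +ₘ c ≡ x → c % m ≡ 0
  +ₘ-fixed⇒%m≡0 x c x+c≡x = [m+n]%o≡m%o⇒n%o≡0 (toℕ x) c m
    (trans (sym (toℕ-+ₘ x c)) (trans (cong toℕ x+c≡x) (sym (toℕ%m≡toℕ x))))

  [c+pred[m]*c]%m≡0 : ∀ c → (c + pred m * c) % m ≡ 0
  [c+pred[m]*c]%m≡0 c = trans (cong (_% m) (m+pred[o]*m≡o*m c m)) (n∣m⇒m%n≡0 (m * c) m (m∣m*n c))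

  +ₘ-reach : ∀ x y → x +ₘ (pred m * toℕ x + toℕ y) ≡ y
  +ₘ-reach x y = toℕ-injective (begin
    toℕ (x +ₘ (pred m * toℕ x + toℕ y))     ≡⟨ toℕ-+ₘ x _ ⟩
    (toℕ x + (pred m * toℕ x + toℕ y)) % m   ≡⟨ cong (_% m) (+-assoc (toℕ x) _ (toℕ y)) ⟨
    (toℕ x + pred m * toℕ x + toℕ y) % m     ≡⟨ cong (λ r → (r + toℕ y) % m) (m+pred[o]*m≡o*m (toℕ x) m) ⟩
    (m * toℕ x + toℕ y) % m                   ≡⟨ %-remove-+ˡ (toℕ y) (m∣m*n (toℕ x)) ⟩
    toℕ y % m                                 ≡⟨ toℕ%m≡toℕ y ⟩
    toℕ y                                     ∎)
    where open ≡-Reasoning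

  act : ℕ → (ℕ → Bool) → Bool × Fin m → Bool × Fin m
  act c w (b , x) = b xor w (toℕ x) , x +ₘ c

  act-∘ : ∀ c w d u a → act d u (act c w a) ≡ act (c + d) (λ y → w y xor u ((y + c) % m)) a
  act-∘ c w d u (b , x) = cong₂ _,_
    (trans (xor-assoc b (w (toℕ x)) _) (cong (λ y → b xor (w (toℕ x) xor u y)) (toℕ-+ₘ x c)))
    (+ₘ-assoc x c d)

  act-identity : ∀ c w {b x} → c % m ≡ 0 → w (toℕ x) ≡ false → act c w (b , x) ≡ (b , x)
  act-identity c w {b} {x} c≡0 wx≡false =
    cong₂ _,_ (trans (cong (b xor_) wx≡false) (xor-identityʳ b)) (+ₘ-identity x c≡0)

  act-fixed⇒%m≡0 : ∀ c w {b x} → act c w (b , x) ≡ (b , x) → c % m ≡ 0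
  act-fixed⇒%m≡0 c w {x = x} fixed = +ₘ-fixed⇒%m≡0 x c (cong proj₂ fixed)

  twist : ℕ → (ℕ → Bool) → (Bool × Fin m) ↔ (Bool × Fin m)
  twist c w = mk↔ₛ′ (act c w) (act c⁻ w⁻) act∘act⁻ act⁻∘act
    where
    open ≡-Reasoning

    c⁻ = pred m * c
    w⁻ = λ y → w ((y + c⁻) % m)

    x+c-c≡x : ∀ x → ((toℕ x + c) % m + c⁻) % m ≡ toℕ x
    x+c-c≡x x = begin
      ((toℕ x + c) % m + c⁻) % m   ≡⟨ cong (λ y → (y + c⁻) % m) (toℕ-+ₘ x c) ⟨
      (toℕ (x +ₘ c) + c⁻) % m      ≡⟨ toℕ-+ₘ (x +ₘ c) c⁻ ⟨
      toℕ (x +ₘ c +ₘ c⁻)           ≡⟨ cong toℕ (+ₘ-assoc x c c⁻) ⟩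
      toℕ (x +ₘ (c + c⁻))          ≡⟨ cong toℕ (+ₘ-identity x ([c+pred[m]*c]%m≡0 c)) ⟩
      toℕ x                        ∎

    act∘act⁻ : ∀ a → act c w (act c⁻ w⁻ a) ≡ a
    act∘act⁻ (b , x) = trans (act-∘ c⁻ w⁻ c w (b , x))
      (act-identity (c⁻ + c) (λ y → w⁻ y xor w⁻ y)
        (trans (cong (_% m) (+-comm c⁻ c)) ([c+pred[m]*c]%m≡0 c)) (xor-same (w⁻ (toℕ x))))

    act⁻∘act : ∀ a → act c⁻ w⁻ (act c w a) ≡ a
    act⁻∘act (b , x) = trans (act-∘ c w c⁻ w⁻ (b , x))
      (act-identity (c + c⁻) (λ y → w y xor w⁻ ((y + c) % m)) ([c+pred[m]*c]%m≡0 c)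
        (trans (cong (λ y → w (toℕ x) xor w y) (x+c-c≡x x)) (xor-same (w (toℕ x)))))

module Construction (m : ℕ) .{{_ : NonZero m}} (s : ℕ) (q∣m : suc (2 * suc s) ∣ m) where
  open TwistedTranslation m
  open Inverse using (to; from; strictlyInverseˡ)

  q : ℕ
  q = suc (2 * suc s)

  encode : Fin (2 * m) ↔ (Bool × Fin m)
  encode = (2↔Bool ×-↔ ↔-id (Fin m)) ↔-∘ *↔×

  open Conjugation encode

  Admissible : ℕ × (ℕ → Bool) → Set
  Admissible (_ , w) = IsPeriodicCoboundary q w

  G : Pred (Permutation′ (2 * m)) 0ℓ
  G = Image Admissible (uncurry twist)

  isPermGroup : IsPermGroup (2 * m) G
  isPermGroup = image-isPermGroup Admissible (uncurry twist)
    ((0 , λ _ → false) , coboundary-false , λ _ → act-identity 0 _ (m<n⇒m%n≡m (>-nonZero⁻¹ m)) refl)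
    (λ { {c , w} {d , u} adm-w adm-u →
         (c + d , λ y → w y xor u ((y + c) % m)) ,
         coboundary-xor adm-w (coboundary-shift q∣m adm-u c) ,
         λ a → sym (act-∘ c w d u a) })
    (λ { {c , w} adm-w → (pred m * c , λ y → w ((y + pred m * c) % m)) ,
                         coboundary-shift q∣m adm-w (pred m * c) ,
                         λ _ → refl })

  isTransitive : IsTransitive (2 * m) G
  isTransitive = image-transitive Admissible (uncurry twist) reach
    where
    b⊕[b⊕b′]≡b′ : ∀ b b′ → b xor (b xor b′) ≡ b′
    b⊕[b⊕b′]≡b′ b b′ = trans (sym (xor-assoc b b b′)) (cong (_xor b′) (xor-same b))

    reach : ∀ a a′ → ∃ λ t → Admissible t × act (proj₁ t) (proj₂ t) a ≡ a′
    reach (b , x) (b′ , y) =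
      let w , adm-w , wx≡b⊕b′ = coboundary-with-value q (s≤s (s≤s z≤n)) (toℕ x) (b xor b′)
      in (pred m * toℕ x + toℕ y , w) , adm-w ,
         cong₂ _,_ (trans (cong (b xor_) wx≡b⊕b′) (b⊕[b⊕b′]≡b′ b b′)) (+ₘ-reach x y)

  act-derangement⇔ : ∀ {c w} → IsPeriodicCoboundary q w → ∀ x → (∀ a → act c w a ≢ a) ⇔ (x +ₘ c ≢ x)
  act-derangement⇔ {c} {w} adm-w x = mk⇔
    (λ no-fixed x+c≡x →
       let z , z<q , wz≡false = coboundary-vanishes (suc s) adm-w
           z<m = <-≤-trans z<q (∣⇒≤ q∣m)
       in no-fixed (false , fromℕ< z<m)
            (act-identity c w (+ₘ-fixed⇒%m≡0 x c x+c≡x) (trans (cong w (toℕ-fromℕ< z<m)) wz≡false)))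
    (λ x+c≢x _ fixed → x+c≢x (+ₘ-identity x (act-fixed⇒%m≡0 c w fixed)))

  block : Fin (2 * m) → Fin m
  block = proj₂ ∘ to encode

  block-surjective : StrictlySurjective _≡_ block
  block-surjective x = from encode (false , x) , cong proj₂ (strictlyInverseˡ encode (false , x))

  derangement⇔ : ∀ {σ} → σ ∈ G → ∀ p → IsDerangement σ ⇔ block (σ ⟨$⟩ʳ p) ≢ block p
  derangement⇔ {σ} ((c , w) , adm-w , σ≈) p =
    ⇔-trans (mk⇔ (derangement-resp-≈ {π = σ} {τ} σ≈) (derangement-resp-≈ {π = τ} {σ} (sym ∘ σ≈)))
      (⇔-trans (conjugate-derangement (twist c w))
        (subst (λ y → (∀ a → act c w a ≢ a) ⇔ y ≢ block p) (sym block[σp]≡)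
          (act-derangement⇔ adm-w (block p))))
    where
    τ = conjugate (twist c w)
    block[σp]≡ : block (σ ⟨$⟩ʳ p) ≡ block p +ₘ c
    block[σp]≡ = trans (cong block (σ≈ p))
                       (cong proj₂ (strictlyInverseˡ encode (act c w (to encode p))))

  completeMultipartite : DerangementGraphCompleteMultipartite G m
  completeMultipartite = complete-multipartite-by-blocks isPermGroup isTransitive block block-surjective
    (from encode (false , fromℕ< (>-nonZero⁻¹ m))) (λ {σ} → derangement⇔ {σ})

theorem3p4 : (m : ℕ) → .{{_ : NonZero m}} → ¬ IsPowerOf2 (2 * m) →
    Σ (Pred (Permutation′ (2 * m)) 0ℓ) λ G →
      IsPermGroup (2 * m) G × IsTransitive (2 * m) G × DerangementGraphCompleteMultipartite G m
theorem3p4 (suc n) not-power with odd-part n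
... | k , zero , 1+n≡2^k =
  contradiction (suc k , cong (2 *_) (trans 1+n≡2^k (*-identityʳ (2 ^ k)))) not-power
... | k , suc s , 1+n≡2^k*q = G , isPermGroup , isTransitive , completeMultipartite
  where open Construction (suc n) s (divides (2 ^ k) 1+n≡2^k*q)
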